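{- The map $\kappa$ from multi-complexes to hypergraphs, extended linearly, satisfies: $\kappa(CD)=\kappa(C)\kappa(D)$ for multi-complexes $C,D$ on disjoint vertex sets; $(\kappa\otimes\kappa)(\Delta_{X,Y}(C))=\Delta^{(\subset)}_{X,Y}(\kappa(C))$ for every multi-complex $C$ with $V(C)=X\sqcup Y$; and $(\kappa\otimes\kappa)(\delta_\sim(C))=\delta^{(\subset)}_\sim(\kappa(C))$ for every multi-complex $C$ and every equivalence $\sim$ on $V(C)$. That is, $\kappa:(\mathbf{MC},m,\Delta)\to(\mathbf{H},m,\Delta^{(\subset)})$ is a twisted bialgebra morphism compatible with the contraction-extraction coproducts $\delta$ and $\delta^{(\subset)}$.
   Context: A multiset is a map $X:S\to\mathbb{N}\setminus\{0\}$, $S=\mathrm{supp}(X)$ its support; $X\subseteq Y$ if $\mathrm{supp}(X)\subseteq\mathrm{supp}(Y)$ and $X(x)\leq Y(x)$ for all $x$. A multi-complex is a triple $C=(V(C),E(C),\leq_C)$: $V(C)$ a finite set; $E(C)$ a multiset of multisets (the edges), each with support in $V(C)$, such that $\emptyset$ and each $\{x\}$, $x\in V(C)$, occur in $E(C)$ with multiplicity $1$; $\leq_C$ a partial order on the elements of $E(C)$ (counted with multiplicity) such that $\{x\}\leq_C e$ iff $x\in\mathrm{supp}(e)$, $\emptyset\leq_C e$ for all $e$, and $e\leq_C f\Rightarrow e\subseteq f$. Product $CD$: vertex set $V(C)\sqcup V(D)$, edge multiset $E(C)\sqcup E(D)$, order the union of $\leq_C$ and $\leq_D$. For $X\subseteq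 V(C)$, $C_{\mid X}$ has vertex set $X$, edges $\{e\in E(C)\mid\mathrm{supp}(e)\subseteq X\}$ and the restricted order; $\Delta_{X,Y}(C)=C_{\mid X}\otimes C_{\mid Y}$. A path in $C$ is a sequence of vertices with consecutive ones in the support of a common edge; connectedness as usual. For an equivalence $\sim$ on $V(C)$ with canonical surjection $\pi_\sim$: $\sim\in\mathcal{E}_c[C]$ iff $C_{\mid\varpi}$ is connected for every class $\varpi$; $C\mid\sim=\prod_{\varpi}C_{\mid\varpi}$; $C/\sim$ has vertex set $V(C)/\sim$, edge multiset $\{\pi_\sim(e)\mid e\in E(C)\}$ (image multisets, all counted separately except the trivial edges $\emptyset$ and singletons, which keep multiplicity $1$), ordered by $\pi_\sim(e)\leq\pi_\sim(f)\iff e\leq_C f$; $\delta_\sim(C)=C/\sim\otimes C\mid\sim$ if $\sim\in\mathcal{E}_c[C]$ and $0$ otherwise. Hypergraphs: pairs $G=(V(G),E(G))$, $V(G)$ finite, $E(G)\subseteq\mathcal{P}(V(G))$ containing $\emptyset$ and all singletons; $G_{\mid_\subset I}$ has edges $\{e\in E(G)\mid e\subseteq I\}$; $\Delta^{(\subset)}_{X,Y}(G)=G_{\mid_\subset X}\otimes G_{\mid_\subset Y}$; $G/\sim$ has vertex set $V(G)/\sim$ and edges $\{\pi_\sim(e)\}$; $G\mid_\subset\sim=\prod_C G_{\mid_\subset C}$; $\delta^{(\subset)}_\sim(G)=G/\sim\otimes G\mid_\subset\sim$ if each $G_{\mid_\subset C}$ is connected, $0$ otherwise. $\kappa(C)$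 is the hypergraph with vertex set $V(C)$ and edge set $\{\mathrm{supp}(e)\mid e\in E(C)\}$ (forgetting multiplicities and the order). -}

module Defs where

open import Level using (Level; _⊔_; Lift) renaming (suc to lsuc)
open import Data.Nat using (ℕ; _≤_)
open import Data.Bool using (if_then_else_)
open import Data.Fin using (Fin)
open import Data.List using (List; map; filter; deduplicate; _++_)
open import Data.Nat.ListAction using (sum)
open import Data.List.Membership.Propositional using (_∈_)
open import Data.List.Relation.Unary.Unique.Propositional using (Unique)
open import Data.Product using (Σ; ∃; _×_; _,_; proj₁; proj₂)
open import Data.Sum using (_⊎_; inj₁; inj₂; [_,_])
open import Data.Empty using (⊥)
open import Relation.Nullary using (does)
open import Relation.Binary.PropositionalEquality using (_≡_; _≢_)
open import Relation.Binary.Definitions using (DecidableEquality)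
open import Function.Bundles using (_⇔_)

Multiset : Set → Set
Multiset A = A → ℕ

supp : {A : Set} → Multiset A → A → Set
supp m x = m x ≢ 0

_⊆ₘ_ : {A : Set} → Multiset A → Multiset A → Set
m ⊆ₘ m' = ∀ x → m x ≤ m' x

IsEmptyM : {A : Set} → Multiset A → Set
IsEmptyM m = ∀ x → m x ≡ 0

IsSingletonM : {A : Set} → A → Multiset A → Set
IsSingletonM x m = m x ≡ 1 × (∀ y → y ≢ x → m y ≡ 0)

ExactlyOne : {I : Set} → (I → Set) → Set
ExactlyOne {I} P = Σ I (λ i → P i × (∀ j → P j → j ≡ i))

-- Multi-complexes with vertex labels in A.
-- V(C) is the duplicate-free list vs; the edges (counted with
-- multiplicity) are indexed by Fin n; _≼_ is the partial order on them.

record MultiComplex (A : Set) : Set₁ where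
  field
    vs        : List A
    vs-unique : Unique vs
    n         : ℕ
    edge      : Fin n → Multiset A
    _≼_       : Fin n → Fin n → Set
    edge-supp : ∀ i x → supp (edge i) x → x ∈ vs
    empty-once     : ExactlyOne (λ i → IsEmptyM (edge i))
    singleton-once : ∀ x → x ∈ vs → ExactlyOne (λ i → IsSingletonM x (edge i))
    ≼-refl    : ∀ i → i ≼ i
    ≼-trans   : ∀ {i j k} → i ≼ j → j ≼ k → i ≼ k
    ≼-antisym : ∀ {i j} → i ≼ j → j ≼ i → i ≡ j
    singleton-≼ : ∀ x i j → IsSingletonM x (edge i) → (i ≼ j ⇔ supp (edge j) x)
    empty-≼   : ∀ i j → IsEmptyM (edge i) → i ≼ j
    ≼-⊆       : ∀ {i j} → i ≼ j → edge i ⊆ₘ edge j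

-- Raw multi-complex data (outputs of the operations; edge index set arbitrary)
record RawMC (A : Set) : Set₁ where
  field
    vs   : List A
    Idx  : Set
    edge : Idx → Multiset A
    _≼_  : Idx → Idx → Set

raw : {A : Set} → MultiComplex A → RawMC A
raw C = record { vs = MultiComplex.vs C ; Idx = Fin (MultiComplex.n C)
               ; edge = MultiComplex.edge C ; _≼_ = MultiComplex._≼_ C }

module _ {A : Set} where
  open RawMC

  ≼⊎ : (R S : RawMC A) → Idx R ⊎ Idx S → Idx R ⊎ Idx S → Set
  ≼⊎ R S (inj₁ i) (inj₁ j) = _≼_ R i j
  ≼⊎ R S (inj₂ i) (inj₂ j) = _≼_ S i j
  ≼⊎ R S _ _ = ⊥

  prodR : RawMC A → RawMC A → RawMC A
  prodR R S = record { vs = vs R ++ vs S ; Idx = Idx R ⊎ Idx S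
                     ; edge = [ edge R , edge S ] ; _≼_ = ≼⊎ R S }

  restrictR : RawMC A → List A → RawMC A
  restrictR R X = record
    { vs = X
    ; Idx = Σ (Idx R) (λ i → ∀ x → supp (edge R i) x → x ∈ X)
    ; edge = λ i → edge R (proj₁ i)
    ; _≼_ = λ i j → _≼_ R (proj₁ i) (proj₁ j) }

  ΔR : RawMC A → List A → List A → RawMC A × RawMC A
  ΔR R X Y = restrictR R X , restrictR R Y

  -- The equivalence ~ is given as the kernel of a map cl : A → K
  -- (x ~ y iff cl x ≡ cl y); V(C)/~ is the image of V(C) under cl.
  module _ {K : Set} (_≟_ : DecidableEquality K) (cl : A → K) where

    imageM : List A → Multiset A → Multiset K
    imageM V m k = sum (map (λ x → if does (cl x ≟ k) then m x else 0) V)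

    quotR : RawMC A → RawMC K
    quotR R = record { vs = deduplicate _≟_ (map cl (vs R)) ; Idx = Idx R
                     ; edge = λ i → imageM (vs R) (edge R i) ; _≼_ = _≼_ R }

    classList : RawMC A → K → List A
    classList R k = filter (λ x → cl x ≟ k) (vs R)

    -- C | ~  =  product over classes of C_{|class}
    restrict∼R : RawMC A → RawMC A
    restrict∼R R = record
      { vs = vs R
      ; Idx = Σ (Idx R) (λ i → ∀ x y → supp (edge R i) x → supp (edge R i) y → cl x ≡ cl y)
      ; edge = λ i → edge R (proj₁ i)
      ; _≼_ = λ i j → _≼_ R (proj₁ i) (proj₁ j) }

  data MPath (R : RawMC A) : A → A → Set where
    here : ∀ {x} → MPath R x x
    step : ∀ {x z y} (i : Idx R) → supp (edge R i) x → supp (edge R i) z →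
           MPath R z y → MPath R x y

  ConnectedR : RawMC A → Set
  ConnectedR R = ∀ x y → x ∈ vs R → y ∈ vs R → MPath R x y

-- "value if condition holds, 0 otherwise" (basis element or zero)

record Cond {a : Level} (h : Level) (X : Set a) : Set (lsuc h ⊔ a) where
  constructor _▹_
  field
    holds : Set h
    val   : X

mapCond : {a b h : Level} {X : Set a} {Y : Set b} → (X → Y) → Cond h X → Cond h Y
mapCond f (h ▹ v) = h ▹ f v

CondEq : {a b h h' r : Level} {X : Set a} {Y : Set b} → (X → Y → Set r) →
         Cond h X → Cond h' Y → Set (h ⊔ h' ⊔ r)
CondEq R c d = (Cond.holds c ⇔ Cond.holds d) × (Cond.holds c → R (Cond.val c) (Cond.val d))

δR : {A K : Set} → DecidableEquality K → (A → K) → RawMC A → Cond Level.zero (RawMC K × RawMC A)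
δR _≟_ cl R =
  (∀ k → k ∈ RawMC.vs (quotR _≟_ cl R) → ConnectedR (restrictR R (classList _≟_ cl R k)))
  ▹ (quotR _≟_ cl R , restrict∼R _≟_ cl R)

Subset : Set → Set₁
Subset A = A → Set

_≐_ : {A : Set} → Subset A → Subset A → Set
s ≐ t = ∀ x → s x ⇔ t x

record Hypergraph (A : Set) : Set₂ where
  field
    vert : Subset A
    edge : Subset A → Set₁

_≅H_ : {A : Set} → Hypergraph A → Hypergraph A → Set₁
G ≅H H = (∀ x → vert G x ⇔ vert H x)
       × (∀ s → edge G s → ∃ λ t → edge H t × s ≐ t)
       × (∀ t → edge H t → ∃ λ s → edge G s × s ≐ t)
  where open Hypergraph

_≅₂_ : {A B : Set} → Hypergraph A × Hypergraph B → Hypergraph A × Hypergraph B → Set₁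
(G , G') ≅₂ (H , H') = G ≅H H × G' ≅H H'

module _ {A : Set} where
  open Hypergraph

  prodH : Hypergraph A → Hypergraph A → Hypergraph A
  prodH G H = record { vert = λ x → vert G x ⊎ vert H x
                     ; edge = λ s → edge G s ⊎ edge H s }

  restrict⊂H : Hypergraph A → Subset A → Hypergraph A
  restrict⊂H G X = record { vert = X ; edge = λ s → edge G s × (∀ x → s x → X x) }

  ΔH : Hypergraph A → Subset A → Subset A → Hypergraph A × Hypergraph A
  ΔH G X Y = restrict⊂H G X , restrict⊂H G Y

  imageS : {K : Set} → (A → K) → Subset A → Subset K
  imageS cl s k = ∃ λ x → s x × cl x ≡ k

  quotH : {K : Set} → (A → K) → Hypergraph A → Hypergraph K
  quotH cl G = record { vert = imageS cl (vert G)
                      ; edge = λ f → ∃ λ s → edge G s × f ≐ imageS cl s }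

  -- G |⊂ ~  =  product over classes of G_{|⊂ class}
  restrict∼H : {K : Set} → (A → K) → Hypergraph A → Hypergraph A
  restrict∼H cl G = record
    { vert = vert G
    ; edge = λ s → edge G s × (∀ x y → s x → s y → cl x ≡ cl y) }

  data HPath (G : Hypergraph A) : A → A → Set₁ where
    here : ∀ {x} → HPath G x x
    step : ∀ {x z y} (s : Subset A) → edge G s → s x → s z → HPath G z y → HPath G x y

  ConnectedH : Hypergraph A → Set₁
  ConnectedH G = ∀ x y → vert G x → vert G y → HPath G x y

  classS : {K : Set} → (A → K) → Hypergraph A → K → Subset A
  classS cl G k x = vert G x × cl x ≡ k

δH : {A K : Set} → (A → K) → Hypergraph A → Cond (lsuc Level.zero) (Hypergraph K × Hypergraph A)
δH cl G =
  (∀ k → Hypergraph.vert (quotH cl G) k → ConnectedH (restrict⊂H G (classS cl G k)))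
  ▹ (quotH cl G , restrict∼H cl G)

κ : {A : Set} → RawMC A → Hypergraph A
κ R = record { vert = λ x → x ∈ RawMC.vs R
             ; edge = λ s → Lift (Level.suc Level.zero) (∃ λ i → s ≐ supp (RawMC.edge R i)) }

κ⊗κ : {A B : Set} → RawMC A × RawMC B → Hypergraph A × Hypergraph B
κ⊗κ (R , S) = κ R , κ S

-- κ only forgets multiplicities and the order, and every operation on
-- multi-complexes is defined edge by edge through the supports: products
-- and restrictions select edges by a condition on their supports, and the
-- quotient replaces each edge by its image multiset, whose support is the
-- image of the support because all multiplicities are positive. Paths are
-- likewise defined through supports, so connectedness of the classes, the
-- condition under which δ is nonzero, is the same on both sides.
module Submission where

open import Defs
open import Level using (lift)
open import Data.Nat using (ℕ; _+_; _≟_)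
open import Data.Nat.Properties using (m+n≡0⇒m≡0; m+n≡0⇒n≡0)
open import Data.Nat.ListAction using (sum)
open import Data.Bool using (if_then_else_)
open import Data.List using (List; []; _∷_; map; deduplicate)
open import Data.List.Membership.Propositional using (_∈_)
open import Data.List.Membership.Propositional.Properties
  using (++-∈⇔; ∈-map⁺; ∈-map⁻; ∈-filter⁺; ∈-filter⁻; ∈-deduplicate⁺; ∈-deduplicate⁻)
open import Data.List.Relation.Unary.Any using (here; there)
open import Data.Product using (_×_; _,_; ∃)
open import Data.Sum using (_⊎_; inj₁; inj₂)
open import Data.Empty using (⊥)
open import Relation.Nullary using (Dec; does; yes; no; contradiction)
open import Relation.Binary.Definitions using (DecidableEquality)
open import Relation.Binary.PropositionalEquality using (_≢_; refl; sym; cong₂)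
open import Function.Bundles using (_⇔_; mk⇔; Equivalence)
import Function.Properties.Equivalence as ⇔

open Equivalence using (to; from)

module _ {A : Set} where
  open Hypergraph

  ≅H-intro : {G H : Hypergraph A} → (∀ x → vert G x ⇔ vert H x) →
             (∀ s → edge G s → edge H s) → (∀ s → edge H s → edge G s) → G ≅H H
  ≅H-intro vert⇔ G⊆H H⊆G =
    vert⇔ , (λ s e → s , G⊆H s e , λ _ → ⇔.refl) , (λ s e → s , H⊆G s e , λ _ → ⇔.refl)

  κ-prodR : (R S : RawMC A) → κ (prodR R S) ≅H prodH (κ R) (κ S)
  κ-prodR R S = ≅H-intro (λ _ → ++-∈⇔)
    (λ { s (lift (inj₁ i , s≐)) → inj₁ (lift (i , s≐))
       ; s (lift (inj₂ i , s≐)) → inj₂ (lift (i , s≐)) })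
    (λ { s (inj₁ (lift (i , s≐))) → lift (inj₁ i , s≐)
       ; s (inj₂ (lift (i , s≐))) → lift (inj₂ i , s≐) })

  κ-restrictR : (R : RawMC A) (X : List A) →
                κ (restrictR R X) ≅H restrict⊂H (κ R) (_∈ X)
  κ-restrictR R X = ≅H-intro (λ _ → ⇔.refl)
    (λ { s (lift ((i , i⊆X) , s≐)) → lift (i , s≐) , λ x sx → i⊆X x (to (s≐ x) sx) })
    (λ { s (lift (i , s≐) , s⊆X) → lift ((i , λ x ix → s⊆X x (from (s≐ x) ix)) , s≐) })

  κ-restrict∼R : {K : Set} (_≟K_ : DecidableEquality K) (cl : A → K) (R : RawMC A) →
                 κ (restrict∼R _≟K_ cl R) ≅H restrict∼H cl (κ R)
  κ-restrict∼R _≟K_ cl R = ≅H-intro (λ _ → ⇔.refl)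
    (λ { s (lift ((i , i-in-class) , s≐)) →
           lift (i , s≐) , λ x y sx sy → i-in-class x y (to (s≐ x) sx) (to (s≐ y) sy) })
    (λ { s (lift (i , s≐) , s-in-class) →
           lift ((i , λ x y ix iy → s-in-class x y (from (s≐ x) ix) (from (s≐ y) iy)) , s≐) })

sum-map≢0⇔ : {A : Set} (f : A → ℕ) (V : List A) →
             sum (map f V) ≢ 0 ⇔ (∃ λ x → x ∈ V × f x ≢ 0)
sum-map≢0⇔ f V = mk⇔ (nonzero-term V) (λ (x , x∈V , fx≢0) → nonzero-sum V x∈V fx≢0)
  where
  nonzero-term : ∀ V → sum (map f V) ≢ 0 → ∃ λ x → x ∈ V × f x ≢ 0
  nonzero-term [] sum≢0 = contradiction refl sum≢0
  nonzero-term (v ∷ V) sum≢0 with f v ≟ 0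
  ... | no fv≢0 = v , here refl , fv≢0
  ... | yes fv≡0 =
    let x , x∈V , fx≢0 = nonzero-term V (λ rest≡0 → sum≢0 (cong₂ _+_ fv≡0 rest≡0))
    in  x , there x∈V , fx≢0

  nonzero-sum : ∀ V {x} → x ∈ V → f x ≢ 0 → sum (map f V) ≢ 0
  nonzero-sum (v ∷ V) (here refl) fx≢0 sum≡0 = fx≢0 (m+n≡0⇒m≡0 (f v) sum≡0)
  nonzero-sum (v ∷ V) (there x∈V) fx≢0 sum≡0 = nonzero-sum V x∈V fx≢0 (m+n≡0⇒n≡0 (f v) sum≡0)

if-does≢0⇔ : {P : Set} (P? : Dec P) (n : ℕ) → (if does P? then n else 0) ≢ 0 ⇔ (P × n ≢ 0)
if-does≢0⇔ (yes p) n = mk⇔ (p ,_) (λ (_ , n≢0) → n≢0)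
if-does≢0⇔ (no ¬p) n = mk⇔ (λ 0≢0 → contradiction refl 0≢0) (λ (p , _) → contradiction p ¬p)

module _ {A : Set} where
  open RawMC

  EdgesOnVertices : RawMC A → Set
  EdgesOnVertices R = ∀ i x → supp (edge R i) x → x ∈ vs R

  module _ (R : RawMC A) {X : List A} {P : Subset A} (X⇔P : ∀ x → x ∈ X ⇔ P x) where

    MPath⇒HPath : ∀ {x y} → MPath (restrictR R X) x y → HPath (restrict⊂H (κ R) P) x y
    MPath⇒HPath here = here
    MPath⇒HPath (step (i , i⊆X) ix iz path) =
      step (supp (edge R i)) (lift (i , λ _ → ⇔.refl) , λ x ix → to (X⇔P x) (i⊆X x ix))
           ix iz (MPath⇒HPath path)

    HPath⇒MPath : ∀ {x y} → HPath (restrict⊂H (κ R) P) x y → MPath (restrictR R X) x y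
    HPath⇒MPath here = here
    HPath⇒MPath (step s (lift (i , s≐) , s⊆P) sx sz path) =
      step (i , λ x ix → from (X⇔P x) (s⊆P x (from (s≐ x) ix)))
           (to (s≐ _) sx) (to (s≐ _) sz) (HPath⇒MPath path)

    connected-κ-restrict : ConnectedR (restrictR R X) ⇔ ConnectedH (restrict⊂H (κ R) P)
    connected-κ-restrict = mk⇔
      (λ conn x y px py → MPath⇒HPath (conn x y (from (X⇔P x) px) (from (X⇔P y) py)))
      (λ conn x y x∈X y∈X → HPath⇒MPath (conn x y (to (X⇔P x) x∈X) (to (X⇔P y) y∈X)))

  imageS-cong : {K : Set} (cl : A → K) {s t : Subset A} → s ≐ t → imageS cl s ≐ imageS cl t
  imageS-cong cl s≐t k = mk⇔ (λ (x , sx , eq) → x , to (s≐t x) sx , eq)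
                             (λ (x , tx , eq) → x , from (s≐t x) tx , eq)

  module _ {K : Set} (_≟K_ : DecidableEquality K) (cl : A → K) where

    -- Positivity of multiplicities makes the support of a sum the union of the supports.
    supp-imageM : (V : List A) (m : Multiset A) → (∀ x → supp m x → x ∈ V) →
                  supp (imageM _≟K_ cl V m) ≐ imageS cl (supp m)
    supp-imageM V m m⊆V k = mk⇔
      (λ img≢0 →
        let x , _ , term≢0 = to (sum-map≢0⇔ _ V) img≢0
            clx≡k , mx≢0 = to (if-does≢0⇔ (cl x ≟K k) (m x)) term≢0
        in  x , mx≢0 , clx≡k)
      (λ (x , mx≢0 , clx≡k) →
        from (sum-map≢0⇔ _ V)
          (x , m⊆V x mx≢0 , from (if-does≢0⇔ (cl x ≟K k) (m x)) (clx≡k , mx≢0)))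

    ∈-deduplicate-map⇔ : (V : List A) (k : K) →
                         k ∈ deduplicate _≟K_ (map cl V) ⇔ imageS cl (_∈ V) k
    ∈-deduplicate-map⇔ V k = mk⇔
      (λ k∈ → let x , x∈V , k≡clx = ∈-map⁻ cl (∈-deduplicate⁻ _≟K_ (map cl V) k∈)
              in  x , x∈V , sym k≡clx)
      (λ { (x , x∈V , refl) → ∈-deduplicate⁺ _≟K_ (∈-map⁺ cl x∈V) })

    ∈-classList⇔ : (R : RawMC A) (k : K) (x : A) →
                   x ∈ classList _≟K_ cl R k ⇔ classS cl (κ R) k x
    ∈-classList⇔ R k x = mk⇔ (∈-filter⁻ (λ y → cl y ≟K k))
                             (λ (x∈V , clx≡k) → ∈-filter⁺ (λ y → cl y ≟K k) x∈V clx≡k)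

    κ-quotR : (R : RawMC A) → EdgesOnVertices R → κ (quotR _≟K_ cl R) ≅H quotH cl (κ R)
    κ-quotR R R-on-vs = ≅H-intro (∈-deduplicate-map⇔ (vs R))
      (λ { s (lift (i , s≐)) →
             supp (edge R i) , lift (i , λ _ → ⇔.refl) ,
             λ k → ⇔.trans (s≐ k) (supp-imageM (vs R) (edge R i) (R-on-vs i) k) })
      (λ { s (t , lift (i , t≐) , s≐) →
             lift (i , λ k → ⇔.trans (s≐ k) (⇔.trans (imageS-cong cl t≐ k)
                                     (⇔.sym (supp-imageM (vs R) (edge R i) (R-on-vs i) k)))) })

    δ-nonzero-κ : (R : RawMC A) →
                  Cond.holds (mapCond κ⊗κ (δR _≟K_ cl R)) ⇔ Cond.holds (δH cl (κ R))
    δ-nonzero-κ R = mk⇔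
      (λ conn k k∈ → to (connected k) (conn k (from (∈-deduplicate-map⇔ (vs R) k) k∈)))
      (λ conn k k∈ → from (connected k) (conn k (to (∈-deduplicate-map⇔ (vs R) k) k∈)))
      where
      connected : ∀ k → ConnectedR (restrictR R (classList _≟K_ cl R k)) ⇔
                        ConnectedH (restrict⊂H (κ R) (classS cl (κ R) k))
      connected k = connected-κ-restrict R (∈-classList⇔ R k)

    κ⊗κ-δR : (R : RawMC A) → EdgesOnVertices R →
             CondEq _≅₂_ (mapCond κ⊗κ (δR _≟K_ cl R)) (δH cl (κ R))
    κ⊗κ-δR R R-on-vs = δ-nonzero-κ R , λ _ → κ-quotR R R-on-vs , κ-restrict∼R _≟K_ cl R

mainTheorem17 : {A : Set} →
    ((C D : MultiComplex A) →
      (∀ x → x ∈ MultiComplex.vs C → x ∈ MultiComplex.vs D → ⊥) →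
      κ (prodR (raw C) (raw D)) ≅H prodH (κ (raw C)) (κ (raw D)))
    × ((C : MultiComplex A) (X Y : List A) →
      (∀ x → x ∈ MultiComplex.vs C ⇔ (x ∈ X ⊎ x ∈ Y)) →
      (∀ x → x ∈ X → x ∈ Y → ⊥) →
      κ⊗κ (ΔR (raw C) X Y) ≅₂ ΔH (κ (raw C)) (_∈ X) (_∈ Y))
    × ({K : Set} (_≟_ : DecidableEquality K) (C : MultiComplex A) (cl : A → K) →
      CondEq _≅₂_ (mapCond κ⊗κ (δR _≟_ cl (raw C))) (δH cl (κ (raw C))))
mainTheorem17 =
    (λ C D _ → κ-prodR (raw C) (raw D))
  , (λ C X Y _ _ → κ-restrictR (raw C) X , κ-restrictR (raw C) Y)
  , (λ _≟K_ C cl → κ⊗κ-δR _≟K_ cl (raw C) (MultiComplex.edge-supp C))
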